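{- Fix an integer $k\ge1$. Let $T$ be a tree, let $S$ be a threshold-$k$ resolving set of $T$, and let $v$ be a vertex with $\deg(v)\ge 3$ from which at least two leaf-paths start, say the leaf-paths $P_1,\dots,P_{L}$ ($L\ge 2$) with lengths $\ell_1,\dots,\ell_L$. Then there exists an index $j^\star\in\{1,\dots,L\}$ such that $|S\cap(V(P_j)\setminus\{v\})|\ge \bar c(\ell_j)$ for all $j\ne j^\star$, and $|S\cap(V(P_{j^\star})\setminus\{v\})|\ge \underline{c}(\ell_{j^\star})$.
   Context: For a graph let $d$ be the graph distance and $d_k(x,y)=\min\{d(x,y),k+1\}$. A threshold-$k$ resolving set of a graph $G=(V,E)$ is a set $S\subseteq V$ such that for every pair of distinct $x,y\in V$ some $s\in S$ has $d_k(s,x)\ne d_k(s,y)$, and for every $x\in V$ some $s\in S$ has $d(s,x)\le k$. A path $P$ in $G$ is a leaf-path (starting at $v$) if $P$ is the induced subgraph of $G$ on $V(P)$, one end vertex of $P$ is a leaf of $G$, the other end vertex $v$ has degree at least 3 in $G$, and all other vertices of $P$ have degree 2 in $G$; its length is its number of edges. For an integer $\ell\ge1$ write $\ell=q(3k+2)+r$ with integers $q\ge0$, $0\le r\le 3k+1$, and define $\bar c(\ell)=2q+\mathbb{1}_{r\ge 1}+\mathbb{1}_{r\ge 2k+2}$ and $\underline{c}(\ell)=2q+\mathbb{1}_{r\ge k+1}+\mathbb{1}_{r\ge 2k+2}$. -}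

module Defs where

open import Data.Nat using (ℕ; zero; suc; _+_; _*_; _≤_; _<_; _≤ᵇ_)
open import Data.Nat.DivMod using (_/_; _%_)
open import Data.Bool using (Bool; true; false; if_then_else_)
open import Data.Fin using (Fin; toℕ; inject₁; fromℕ)
open import Data.Fin.Subset using (Subset; _∈_; _∩_; _─_; ⁅_⁆; ⋃; ∣_∣)
open import Data.Vec using (tabulate)
open import Data.List using (List)
import Data.List as List
open import Data.Product using (Σ; ∃; ∃-syntax; _×_)
open import Data.Sum using (_⊎_)
open import Data.Empty using (⊥)
open import Relation.Nullary using (¬_)
open import Relation.Binary.PropositionalEquality using (_≡_; _≢_)
open import Function.Definitions using (Injective)

record Graph (n : ℕ) : Set where
  field
    adj    : Fin n → Fin n → Bool
    sym    : ∀ x y → adj x y ≡ adj y x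
    irrefl : ∀ x → adj x x ≡ false
open Graph public

module _ {n : ℕ} (G : Graph n) where

  Adj : Fin n → Fin n → Set
  Adj x y = adj G x y ≡ true

  data Walk : Fin n → Fin n → ℕ → Set where
    [] : ∀ {x} → Walk x x 0
    _∷_ : ∀ {x y z m} → Adj x y → Walk y z m → Walk x z (suc m)

  Dist : Fin n → Fin n → ℕ → Set
  Dist x y d = Walk x y d × (∀ m → m < d → ¬ Walk x y m)

  DistK : ℕ → Fin n → Fin n → ℕ → Set
  DistK k x y t =
      (t ≤ k × Dist x y t)
    ⊎ (t ≡ suc k × (∀ m → m ≤ k → ¬ Walk x y m))

  nbhd : Fin n → Subset n
  nbhd v = tabulate (adj G v)

  deg : Fin n → ℕ
  deg v = ∣ nbhd v ∣

  Connected : Set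
  Connected = ∀ x y → ∃[ m ] Walk x y m

  IsCycle : (m : ℕ) → (Fin (suc (suc (suc m))) → Fin n) → Set
  IsCycle m c =
      Injective _≡_ _≡_ c
    × (∀ i → Adj (c (inject₁ i)) (c (Fin.suc i)))
    × Adj (c (fromℕ (suc (suc m)))) (c Fin.zero)

  Acyclic : Set
  Acyclic = ∀ m c → ¬ IsCycle m c

  IsTree : Set
  IsTree = Connected × Acyclic

  ThresholdResolving : ℕ → Subset n → Set
  ThresholdResolving k S =
      (∀ x y → x ≢ y →
         ∃[ s ] (s ∈ S × (∀ t t′ → DistK k s x t → DistK k s y t′ → t ≢ t′)))
    × (∀ x → ∃[ s ] (s ∈ S × ∃[ d ] (d ≤ k × Dist s x d)))

  -- P = P_0 P_1 … P_ℓ is a leaf-path of length ℓ starting at v: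
  -- P_0 = v, P is a path (distinct vertices, consecutive ones adjacent),
  -- P is induced, P_ℓ is a leaf, deg v ≥ 3, inner vertices have degree 2.
  IsLeafPathFrom : Fin n → (ℓ : ℕ) → (Fin (suc ℓ) → Fin n) → Set
  IsLeafPathFrom v ℓ P =
      P Fin.zero ≡ v
    × Injective _≡_ _≡_ P
    × (∀ (i : Fin ℓ) → Adj (P (inject₁ i)) (P (Fin.suc i)))
    × (∀ i j → Adj (P i) (P j) → toℕ i ≡ suc (toℕ j) ⊎ toℕ j ≡ suc (toℕ i))
    × deg (P (fromℕ ℓ)) ≡ 1
    × 3 ≤ deg v
    × (∀ (i : Fin (suc ℓ)) → 0 < toℕ i → toℕ i < ℓ → deg (P i) ≡ 2)

pathVertices : ∀ {n ℓ} → (Fin (suc ℓ) → Fin n) → List (Fin n)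
pathVertices P = List.tabulate P

V : ∀ {n ℓ} → (Fin (suc ℓ) → Fin n) → Subset n
V P = ⋃ (List.map ⁅_⁆ (pathVertices P))

countOn : ∀ {n ℓ} → Subset n → (Fin (suc ℓ) → Fin n) → Fin n → ℕ
countOn S P v = ∣ S ∩ (V P ─ ⁅ v ⁆) ∣

ind : Bool → ℕ
ind b = if b then 1 else 0

cbar : ℕ → ℕ → ℕ
cbar k ℓ = 2 * (ℓ / suc (suc (3 * k)))
         + ind (1 ≤ᵇ (ℓ % suc (suc (3 * k))))
         + ind (suc (suc (2 * k)) ≤ᵇ (ℓ % suc (suc (3 * k))))

cunder : ℕ → ℕ → ℕ
cunder k ℓ = 2 * (ℓ / suc (suc (3 * k)))
           + ind (suc k ≤ᵇ (ℓ % suc (suc (3 * k))))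
           + ind (suc (suc (2 * k)) ≤ᵇ (ℓ % suc (suc (3 * k))))

{-# OPTIONS --safe #-}

-- Walk along a leaf path from v and mark the positions occupied by S. A vertex at
-- position i > k can only be dominated from inside the path, so some mark lies within k
-- of it; the two neighbours of an inner mark a > k + 1 can only be told apart from within
-- k + 1 of a, so such a mark has a partner mark nearby. A left-to-right scan shows that
-- these two constraints force c̲(ℓ) marks on a path of length ℓ, and c̄(ℓ) marks once some
-- mark lies among the first k + 1 positions (restart the scan at that mark). If two paths
-- both lacked such an early mark, their vertices next to v would be unresolved: a vertex
-- of S off both paths reaches them at equal distance through v, and a mark deep inside
-- one of the paths is farther than k from both.

module Submission where

open import Data.Bool using (Bool; true; false; if_then_else_)
import Data.Bool.Properties as Bool
open import Data.Empty using (⊥)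
open import Data.Fin using (Fin; toℕ)
import Data.Fin as F
import Data.Fin.Properties as Fin
open import Data.Fin.Subset using (Subset; _∈_; ⁅_⁆; ⋃; ∣_∣; _-_)
open import Data.Fin.Subset.Properties
  using (_∈?_; x∈p∧x≢y⇒x∈p-y; x∈p⇒∣p-x∣<∣p∣; x∈p∩q⁺; x∈p∧x∉q⇒x∈p─q; x∈p∪q⁺; x∈⁅y⁆⇒x≡y; x∈⁅x⁆)
import Data.List as List
import Data.List.Properties as List
open import Data.Nat
open import Data.Nat.DivMod using (m<n⇒m/n≡0; m<n⇒m%n≡m; m/n≡1+[m∸n]/n; [m+n]%n≡m%n)
open import Data.Nat.Properties
open import Algebra.Properties.CommutativeSemigroup +-commutativeSemigroup using (xy∙z≈xz∙y)
open import Data.Nat.Tactic.RingSolver using (solve-∀)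
open import Data.Product using (∃-syntax; _×_; _,_; proj₁; proj₂)
open import Data.Sum using (_⊎_; inj₁; inj₂)
open import Data.Vec using (tabulate)
open import Data.Vec.Properties using (lookup⇒[]=; lookup∘tabulate)
open import Function using (_∘_)
open import Relation.Binary.Definitions using (tri<; tri≈; tri>)
open import Relation.Binary.PropositionalEquality
open import Relation.Nullary using (¬_; Dec; yes; no; does; contradiction)
open import Relation.Nullary.Decidable using (dec-true; _×-dec_)
open import Defs hiding (sym)

ind≤1 : ∀ b → ind b ≤ 1
ind≤1 true  = ≤-refl
ind≤1 false = z≤n

ind-≤ᵇ-< : ∀ {a r} → r < a → ind (a ≤ᵇ r) ≡ 0
ind-≤ᵇ-< {a} {r} r<a with a ≤ᵇ r | ≤ᵇ⇒≤ a r
... | false | _      = refl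
... | true  | a≤r = contradiction (a≤r _) (<⇒≱ r<a)

module Periodic (m : ℕ) where

  periodic : ℕ → ℕ → ℕ → ℕ
  periodic x₀ x₁ zero          = x₀
  periodic x₀ x₁ (suc zero)    = x₁
  periodic x₀ x₁ (suc (suc c)) = periodic x₀ x₁ c + suc m

  periodic-+ : ∀ x₀ x₁ a c → periodic x₀ x₁ c + a ≡ periodic (x₀ + a) (x₁ + a) c
  periodic-+ x₀ x₁ a zero          = refl
  periodic-+ x₀ x₁ a (suc zero)    = refl
  periodic-+ x₀ x₁ a (suc (suc c)) =
    trans (xy∙z≈xz∙y (periodic x₀ x₁ c) (suc m) a) (cong (_+ suc m) (periodic-+ x₀ x₁ a c))

  periodic-suc : ∀ x₀ x₁ c → periodic x₀ x₁ (suc c) ≡ periodic x₁ (x₀ + suc m) c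
  periodic-suc x₀ x₁ zero          = refl
  periodic-suc x₀ x₁ (suc zero)    = refl
  periodic-suc x₀ x₁ (suc (suc c)) = cong (_+ suc m) (periodic-suc x₀ x₁ c)

  periodic-mono-≤ : ∀ {x₀ x₁ y₀ y₁} → x₀ ≤ y₀ → x₁ ≤ y₁ → ∀ c → periodic x₀ x₁ c ≤ periodic y₀ y₁ c
  periodic-mono-≤ h₀ h₁ zero          = h₀
  periodic-mono-≤ h₀ h₁ (suc zero)    = h₁
  periodic-mono-≤ h₀ h₁ (suc (suc c)) = +-monoˡ-≤ (suc m) (periodic-mono-≤ h₀ h₁ c)

  +-≤-periodic : ∀ {x₀ x₁ y₀ y₁} a → x₀ + a ≤ y₀ → x₁ + a ≤ y₁ →
                 ∀ c → periodic x₀ x₁ c + a ≤ periodic y₀ y₁ c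
  +-≤-periodic {x₀} {x₁} a h₀ h₁ c =
    ≤-trans (≤-reflexive (periodic-+ x₀ x₁ a c)) (periodic-mono-≤ h₀ h₁ c)

  periodicCount : ℕ → ℕ → ℕ → ℕ
  periodicCount a b ℓ = 2 * (ℓ / suc m) + ind (a ≤ᵇ ℓ % suc m) + ind (b ≤ᵇ ℓ % suc m)

  periodicCount-+period : ∀ a b ℓ → periodicCount a b (ℓ + suc m) ≡ 2 + periodicCount a b ℓ
  periodicCount-+period a b ℓ =
    trans (cong₂ (λ q r → 2 * q + ind (a ≤ᵇ r) + ind (b ≤ᵇ r)) quot ([m+n]%n≡m%n ℓ (suc m)))
          (regroup (ℓ / suc m) _ _)
    where
    quot : (ℓ + suc m) / suc m ≡ suc (ℓ / suc m)
    quot = trans (m/n≡1+[m∸n]/n (m≤n+m (suc m) ℓ)) (cong (λ x → suc (x / suc m)) (m+n∸n≡m ℓ (suc m)))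
    regroup : ∀ q x y → 2 * suc q + x + y ≡ 2 + (2 * q + x + y)
    regroup = solve-∀

  periodicCount-<period : ∀ a b ℓ → ℓ < suc m → periodicCount a b ℓ ≡ ind (a ≤ᵇ ℓ) + ind (b ≤ᵇ ℓ)
  periodicCount-<period a b ℓ ℓ<M rewrite m<n⇒m/n≡0 ℓ<M | m<n⇒m%n≡m ℓ<M = refl

  periodicCount-≤ : ∀ {a b x₀ x₁} → x₀ < a → x₀ < b → x₁ < b → b ≤ suc m →
                    ∀ c {ℓ} → ℓ ≤ periodic x₀ x₁ c → periodicCount a b ℓ ≤ c
  periodicCount-≤ {a} {b} x₀<a x₀<b x₁<b b≤M zero {ℓ} ℓ≤x₀
    rewrite periodicCount-<period a b ℓ (<-≤-trans (≤-<-trans ℓ≤x₀ x₀<b) b≤M)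
          | ind-≤ᵇ-< (≤-<-trans ℓ≤x₀ x₀<a) | ind-≤ᵇ-< (≤-<-trans ℓ≤x₀ x₀<b) = z≤n
  periodicCount-≤ {a} {b} x₀<a x₀<b x₁<b b≤M (suc zero) {ℓ} ℓ≤x₁
    rewrite periodicCount-<period a b ℓ (<-≤-trans (≤-<-trans ℓ≤x₁ x₁<b) b≤M)
          | ind-≤ᵇ-< (≤-<-trans ℓ≤x₁ x₁<b) = ≤-trans (≤-reflexive (+-identityʳ _)) (ind≤1 _)
  periodicCount-≤ {a} {b} x₀<a x₀<b x₁<b b≤M (suc (suc c)) {ℓ} ℓ≤ with ℓ <? suc m
  ... | yes ℓ<M = begin
    periodicCount a b ℓ             ≡⟨ periodicCount-<period a b ℓ ℓ<M ⟩
    ind (a ≤ᵇ ℓ) + ind (b ≤ᵇ ℓ)     ≤⟨ +-mono-≤ (ind≤1 (a ≤ᵇ ℓ)) (ind≤1 (b ≤ᵇ ℓ)) ⟩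
    2                               ≤⟨ m≤m+n 2 c ⟩
    suc (suc c)                     ∎
    where open ≤-Reasoning
  ... | no ℓ≮M = begin
    periodicCount a b ℓ             ≡⟨ cong (periodicCount a b) (sym (m∸n+n≡m M≤ℓ)) ⟩
    periodicCount a b (ℓ′ + suc m)  ≡⟨ periodicCount-+period a b ℓ′ ⟩
    2 + periodicCount a b ℓ′        ≤⟨ +-monoʳ-≤ 2 (periodicCount-≤ x₀<a x₀<b x₁<b b≤M c ℓ′≤) ⟩
    suc (suc c)                     ∎
    where
    open ≤-Reasoning
    M≤ℓ = ≮⇒≥ ℓ≮M
    ℓ′ = ℓ ∸ suc m
    ℓ′≤ : ℓ′ ≤ periodic _ _ c
    ℓ′≤ = ≤-trans (∸-monoˡ-≤ (suc m) ℓ≤) (≤-reflexive (m+n∸n≡m _ (suc m)))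

private
  2k+1≡1+2k : ∀ k → suc k + k ≡ suc (2 * k)
  2k+1≡1+2k = solve-∀

  3k+2≡3k+2 : ∀ k → suc k + k + suc k ≡ suc (suc (3 * k))
  3k+2≡3k+2 = solve-∀

module Budget (k : ℕ) where

  open Periodic (suc (3 * k)) public

  -- The largest possible position of the last of c landmarks, the same when that
  -- landmark has another one at most k + 1 before it, and the largest coverable length.
  lastBound pairedBound lengthBound : ℕ → ℕ
  lastBound   = periodic 0 (suc k + k)
  pairedBound = periodic 0 (suc k)
  lengthBound = periodic k (suc k + k)

  private
    2k+1<2k+2 : suc k + k < suc (suc (2 * k))
    2k+1<2k+2 = s≤s (≤-reflexive (2k+1≡1+2k k))

    2k+2≤3k+2 : suc (suc (2 * k)) ≤ suc (suc (3 * k))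
    2k+2≤3k+2 = s≤s (s≤s (*-monoˡ-≤ k (m≤m+n 2 1)))

    3k+2≤3k+2 : suc k + k + suc k ≤ suc (suc (3 * k))
    3k+2≤3k+2 = ≤-reflexive (3k+2≡3k+2 k)

  -- cbar k and cunder k are periodicCount 1 (2k+2) and periodicCount (k+1) (2k+2) on the nose.
  cbar-≤ : ∀ c {ℓ} → ℓ ≤ lastBound c → cbar k ℓ ≤ c
  cbar-≤ = periodicCount-≤ z<s z<s 2k+1<2k+2 2k+2≤3k+2

  cunder-≤ : ∀ c {ℓ} → ℓ ≤ lengthBound c → cunder k ℓ ≤ c
  cunder-≤ = periodicCount-≤ ≤-refl (≤-<-trans (m≤n+m k (suc k)) 2k+1<2k+2) 2k+1<2k+2 2k+2≤3k+2

  lastBound+k+1≤pairedBound : ∀ c → lastBound c + suc k ≤ pairedBound (suc c)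
  lastBound+k+1≤pairedBound c =
    ≤-trans (+-≤-periodic (suc k) ≤-refl 3k+2≤3k+2 c) (≤-reflexive (sym (periodic-suc 0 (suc k) c)))

  pairedBound+2k+1≤lastBound : ∀ c → pairedBound c + (suc k + k) ≤ lastBound (suc c)
  pairedBound+2k+1≤lastBound c =
    ≤-trans (+-≤-periodic (suc k + k) ≤-refl (≤-trans (≤-reflexive (+-comm (suc k) (suc k + k))) 3k+2≤3k+2) c)
            (≤-reflexive (sym (periodic-suc 0 (suc k + k) c)))

  pairedBound≤lastBound : ∀ c → pairedBound c ≤ lastBound c
  pairedBound≤lastBound = periodic-mono-≤ z≤n (m≤m+n (suc k) k)

  lastBound≤lengthBound : ∀ c → lastBound c ≤ lengthBound c
  lastBound≤lengthBound = periodic-mono-≤ z≤n ≤-refl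

  pairedBound+k≤lengthBound : ∀ c → pairedBound c + k ≤ lengthBound c
  pairedBound+k≤lengthBound = +-≤-periodic k ≤-refl ≤-refl

  lengthBound+k+1≤lastBound : ∀ c → lengthBound c + suc k ≤ lastBound (suc c)
  lengthBound+k+1≤lastBound c =
    ≤-trans (+-≤-periodic (suc k) (≤-reflexive (+-comm k (suc k))) 3k+2≤3k+2 c)
            (≤-reflexive (sym (periodic-suc 0 (suc k + k) c)))

-- count s x counts the landmarks at positions 1 … x and last s x is the largest of them,
-- or 0 if there is none; position 0 will be the branch vertex v.
count : (ℕ → Bool) → ℕ → ℕ
count s zero    = 0
count s (suc x) = ind (s (suc x)) + count s x

last : (ℕ → Bool) → ℕ → ℕ
last s zero    = 0
last s (suc x) = if s (suc x) then suc x else last s x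

module _ (s : ℕ → Bool) where

  last-≤ : ∀ x → last s x ≤ x
  last-≤ zero    = z≤n
  last-≤ (suc x) with s (suc x)
  ... | true  = ≤-refl
  ... | false = m≤n⇒m≤1+n (last-≤ x)

  ≤-last : ∀ {b} x → s b ≡ true → b ≤ x → b ≤ last s x
  ≤-last zero    _  b≤x = b≤x
  ≤-last (suc x) sb b≤x with s (suc x) in eq
  ... | true  = b≤x
  ... | false with m≤n⇒m<n∨m≡n b≤x
  ...   | inj₁ b<1+x = ≤-last x sb (≤-pred b<1+x)
  ...   | inj₂ refl  = contradiction (trans (sym sb) eq) λ ()

  last-landmark : ∀ x → 1 ≤ last s x → s (last s x) ≡ true
  last-landmark (suc x) p with s (suc x) in eq
  ... | true  = eq
  ... | false = last-landmark x p

  last-pos⇒count-pos : ∀ x → 1 ≤ last s x → 1 ≤ count s x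
  last-pos⇒count-pos (suc x) p with s (suc x)
  ... | true  = s≤s z≤n
  ... | false = last-pos⇒count-pos x p

  count-pos : ∀ {a} → s a ≡ true → 1 ≤ a → 1 ≤ count s a
  count-pos {suc a} sa _ rewrite sa = s≤s z≤n

  count-+ : ∀ x a → count s (x + a) ≡ count (λ i → s (i + a)) x + count s a
  count-+ zero    a = refl
  count-+ (suc x) a = trans (cong (ind (s (suc x + a)) +_) (count-+ x a))
                            (sym (+-assoc (ind (s (suc x + a))) _ _))

Covers : ℕ → ℕ → (ℕ → Bool) → Set
Covers k ℓ s = ∀ i → suc k ≤ i → i ≤ ℓ → ∃[ a ] (s a ≡ true × a ≤ ℓ × i ≤ a + k × a ≤ i + k)

Paired : ℕ → ℕ → (ℕ → Bool) → Set
Paired k ℓ s = ∀ a → s a ≡ true → suc (suc k) ≤ a → suc a ≤ ℓ →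
               ∃[ b ] (s b ≡ true × b ≤ ℓ × b ≢ a × b ≤ a + suc k × a ≤ b + suc k)

module Scan (k ℓ : ℕ) (s : ℕ → Bool) (covers : Covers k ℓ s) (paired : Paired k ℓ s) where

  open Budget k

  PairedLastBound : ℕ → Set
  PairedLastBound x = ∀ b → s b ≡ true → b < last s x → last s x ≤ b + suc k →
                      last s x ≤ pairedBound (count s x)

  Invariant : ℕ → Set
  Invariant x = last s x ≤ lastBound (count s x) × PairedLastBound x

  small-last≤pairedBound : ∀ x → last s x ≤ suc k → last s x ≤ pairedBound (count s x)
  small-last≤pairedBound x p≤ with last s x | last-pos⇒count-pos s x
  ... | zero  | _   = z≤n
  ... | suc p | pos with count s x | pos (s≤s z≤n)
  ...   | suc c | _ = ≤-trans p≤ (m+n≤o⇒n≤o (lastBound c) (lastBound+k+1≤pairedBound c))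

  -- If no landmark follows the last one closely, Paired supplies a partner before it.
  last≤pairedBound : ∀ x → PairedLastBound x → last s x < ℓ →
                     (∀ b → s b ≡ true → b ≤ ℓ → b ≤ last s x + suc k → b ≤ x) →
                     last s x ≤ pairedBound (count s x)
  last≤pairedBound x pairedLast p<ℓ noneAfter with last s x ≤? suc k
  ... | yes p≤ = small-last≤pairedBound x p≤
  ... | no p≰ with paired (last s x) (last-landmark s x (≤-trans (s≤s z≤n) p>)) p> p<ℓ
    where p> = ≰⇒> p≰
  ...   | b , sb , b≤ℓ , b≢p , b≤ , p≤ with <-cmp b (last s x)
  ...     | tri< b<p _ _ = pairedLast b sb b<p p≤
  ...     | tri≈ _ b≡p _ = contradiction b≡p b≢p
  ...     | tri> _ _ p<b = contradiction (≤-last s x sb (noneAfter b sb b≤ℓ b≤)) (<⇒≱ p<b)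

  -- Covers applied at position last + k + 1.
  gap-after-last : ∀ x → suc x ≤ ℓ → last s x + suc k ≤ x → suc x ≤ last s x + (suc k + k)
  gap-after-last x x<ℓ far
    with covers (last s x + suc k) (m≤n+m (suc k) _) (≤-trans far (<⇒≤ x<ℓ))
  ... | a , sa , _ , i≤a+k , a≤i+k with suc x ≤? a
  ...   | yes x<a = ≤-trans x<a (≤-trans a≤i+k (≤-reflexive (+-assoc (last s x) (suc k) k)))
  ...   | no x≮a  = contradiction (≤-trans i≤a+k (+-monoˡ-≤ k (≤-last s x sa (≤-pred (≰⇒> x≮a)))))
                                  (<⇒≱ (≤-reflexive (sym (+-suc (last s x) k))))

  invariant-step : ∀ x → suc x ≤ ℓ → Invariant x → Invariant (suc x)
  invariant-step x x<ℓ (last≤ , pairedLast) with s (suc x)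
  ... | false = last≤ , pairedLast
  ... | true  = last≤′ , pairedLast′
    where
    p = last s x
    c = count s x

    close : suc x ≤ p + suc k → suc x ≤ pairedBound (suc c)
    close h = ≤-trans h (≤-trans (+-monoˡ-≤ (suc k) last≤) (lastBound+k+1≤pairedBound c))

    pairedLast′ : ∀ b → s b ≡ true → b < suc x → suc x ≤ b + suc k → suc x ≤ pairedBound (suc c)
    pairedLast′ b sb b≤x h = close (≤-trans h (+-monoˡ-≤ (suc k) (≤-last s x sb (≤-pred b≤x))))

    last≤′ : suc x ≤ lastBound (suc c)
    last≤′ with suc x ≤? p + suc k
    ... | yes near = ≤-trans (close near) (pairedBound≤lastBound (suc c))
    ... | no far   = begin
      suc x                     ≤⟨ gap-after-last x x<ℓ p+k<x ⟩
      p + (suc k + k)           ≤⟨ +-monoˡ-≤ (suc k + k) p≤pairedBound ⟩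
      pairedBound c + (suc k + k) ≤⟨ pairedBound+2k+1≤lastBound c ⟩
      lastBound (suc c)         ∎
      where
      open ≤-Reasoning
      p+k<x : p + suc k ≤ x
      p+k<x = ≤-pred (≰⇒> far)
      p≤pairedBound : p ≤ pairedBound c
      p≤pairedBound = last≤pairedBound x pairedLast (≤-<-trans (last-≤ s x) x<ℓ)
                        (λ b _ _ b≤ → ≤-trans b≤ p+k<x)

  invariant : ∀ x → x ≤ ℓ → Invariant x
  invariant zero    _   = z≤n , λ _ _ ()
  invariant (suc x) x<ℓ = invariant-step x x<ℓ (invariant x (<⇒≤ x<ℓ))

  ≤-lengthBound : ℓ ≤ lengthBound (count s ℓ)
  ≤-lengthBound with invariant ℓ ≤-refl | m≤n⇒m<n∨m≡n (last-≤ s ℓ)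
  ... | last≤ , _ | inj₂ p≡ℓ =
    ≤-trans (≤-reflexive (sym p≡ℓ)) (≤-trans last≤ (lastBound≤lengthBound (count s ℓ)))
  ... | _ , pairedLast | inj₁ p<ℓ with ℓ ≤? k
  ...   | yes ℓ≤k =
    ≤-trans ℓ≤k (m+n≤o⇒n≤o (pairedBound (count s ℓ)) (pairedBound+k≤lengthBound (count s ℓ)))
  ...   | no ℓ≰k with covers ℓ (≰⇒> ℓ≰k) ≤-refl
  ...     | a , sa , a≤ℓ , ℓ≤a+k , _ = begin
    ℓ                          ≤⟨ ℓ≤a+k ⟩
    a + k                      ≤⟨ +-monoˡ-≤ k (≤-trans (≤-last s ℓ sa a≤ℓ) p≤) ⟩
    pairedBound (count s ℓ) + k ≤⟨ pairedBound+k≤lengthBound (count s ℓ) ⟩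
    lengthBound (count s ℓ)    ∎
    where
    open ≤-Reasoning
    p≤ = last≤pairedBound ℓ pairedLast p<ℓ (λ _ _ b≤ℓ _ → b≤ℓ)

  cunder-≤-count : cunder k ℓ ≤ count s ℓ
  cunder-≤-count = cunder-≤ (count s ℓ) ≤-lengthBound

private
  offset : ∀ {a b} → a ≤ b → ∃[ b′ ] b ≡ b′ + a
  offset {a} a≤b with m≤n⇒∃[o]m+o≡n a≤b
  ... | o , a+o≡b = o , trans (sym a+o≡b) (+-comm a o)

  cancel-offset : ∀ {x y a} k → x + a ≤ y + a + k → x ≤ y + k
  cancel-offset {x} {y} {a} k h = +-cancelʳ-≤ a x (y + k) (≤-trans h (≤-reflexive (xy∙z≈xz∙y y a k)))

  offset-after : ∀ {a b} c → c + a ≤ b + c → ∃[ b′ ] b ≡ b′ + a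
  offset-after {a} {b} c h = offset (+-cancelˡ-≤ c a b (≤-trans h (≤-reflexive (+-comm b c))))

module _ {k ℓ a : ℕ} {s : ℕ → Bool} where

  covers-shift : Covers k (ℓ + a) s → Covers k ℓ (λ i → s (i + a))
  covers-shift covers i k<i i≤ℓ with covers (i + a) (≤-trans k<i (m≤m+n i a)) (+-monoˡ-≤ a i≤ℓ)
  ... | b , sb , b≤ℓ , i≤b+k , b≤i+k
    with offset-after k (≤-trans (+-monoˡ-≤ a (≤-trans (n≤1+n k) k<i)) i≤b+k)
  ...   | b′ , refl = b′ , sb , +-cancelʳ-≤ a b′ ℓ b≤ℓ , cancel-offset k i≤b+k , cancel-offset k b≤i+k

  paired-shift : Paired k (ℓ + a) s → Paired k ℓ (λ i → s (i + a))
  paired-shift paired a′ sa′ k+1<a′ a′<ℓ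
    with paired (a′ + a) sa′ (≤-trans k+1<a′ (m≤m+n a′ a)) (+-monoˡ-≤ a a′<ℓ)
  ... | b , sb , b≤ℓ , b≢a , b≤a+k , a≤b+k
    with offset-after (suc k) (≤-trans (+-monoˡ-≤ a (≤-trans (n≤1+n _) k+1<a′)) a≤b+k)
  ...   | b′ , refl = b′ , sb , +-cancelʳ-≤ a b′ ℓ b≤ℓ , (λ b′≡a′ → b≢a (cong (_+ a) b′≡a′)) ,
                      cancel-offset (suc k) b≤a+k , cancel-offset (suc k) a≤b+k

-- Restarting the line at a landmark a ≤ k + 1 costs at most k + 1 in length.
cbar-≤-count : ∀ {k ℓ s a} → Covers k ℓ s → Paired k ℓ s →
               s a ≡ true → 1 ≤ a → a ≤ suc k → a ≤ ℓ → cbar k ℓ ≤ count s ℓ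
cbar-≤-count {k} {s = s} {a} covers paired sa 1≤a a≤k+1 a≤ℓ with offset a≤ℓ
... | ℓ′ , refl = ≤-trans (cbar-≤ (suc c′) ℓ≤) (begin
    suc c′              ≡⟨ +-comm 1 c′ ⟩
    c′ + 1              ≤⟨ +-monoʳ-≤ c′ (count-pos s sa 1≤a) ⟩
    c′ + count s a      ≡⟨ count-+ s ℓ′ a ⟨
    count s (ℓ′ + a)    ∎)
  where
  open ≤-Reasoning
  open Budget k
  s′ : ℕ → Bool
  s′ i = s (i + a)
  c′ = count s′ ℓ′
  ℓ≤ : ℓ′ + a ≤ lastBound (suc c′)
  ℓ≤ = ≤-trans (+-mono-≤ (Scan.≤-lengthBound k ℓ′ s′ (covers-shift covers) (paired-shift paired)) a≤k+1)
               (lengthBound+k+1≤lastBound c′)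

x∈p⇒1≤∣p∣ : ∀ {n} {p : Subset n} {x} → x ∈ p → 1 ≤ ∣ p ∣
x∈p⇒1≤∣p∣ x∈p = ≤-trans (s≤s z≤n) (x∈p⇒∣p-x∣<∣p∣ x∈p)

x,y∈p⇒2≤∣p∣ : ∀ {n} {p : Subset n} {x y} → x ∈ p → y ∈ p → x ≢ y → 2 ≤ ∣ p ∣
x,y∈p⇒2≤∣p∣ x∈p y∈p x≢y =
  ≤-trans (s≤s (x∈p⇒1≤∣p∣ (x∈p∧x≢y⇒x∈p-y y∈p (x≢y ∘ sym)))) (x∈p⇒∣p-x∣<∣p∣ x∈p)

x,y,z∈p⇒3≤∣p∣ : ∀ {n} {p : Subset n} {x y z} → x ∈ p → y ∈ p → z ∈ p →
                x ≢ y → x ≢ z → y ≢ z → 3 ≤ ∣ p ∣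
x,y,z∈p⇒3≤∣p∣ x∈p y∈p z∈p x≢y x≢z y≢z =
  ≤-trans (s≤s (x,y∈p⇒2≤∣p∣ (x∈p∧x≢y⇒x∈p-y y∈p (x≢y ∘ sym)) (x∈p∧x≢y⇒x∈p-y z∈p (x≢z ∘ sym)) y≢z))
          (x∈p⇒∣p-x∣<∣p∣ x∈p)

module _ {n : ℕ} (T : Graph n) where

  Adj-sym : ∀ {x y} → Adj T x y → Adj T y x
  Adj-sym {x} {y} e = trans (Graph.sym T y x) e

  Adj⇒≢ : ∀ {x y} → Adj T x y → x ≢ y
  Adj⇒≢ {x} e refl = contradiction (trans (sym e) (irrefl T x)) λ ()

  Adj⇒∈nbhd : ∀ {u y} → Adj T u y → y ∈ nbhd T u
  Adj⇒∈nbhd {u} {y} e = lookup⇒[]= y (tabulate (adj T u)) (trans (lookup∘tabulate (adj T u) y) e)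

  2≤deg : ∀ {u x y} → Adj T u x → Adj T u y → x ≢ y → 2 ≤ deg T u
  2≤deg ex ey = x,y∈p⇒2≤∣p∣ (Adj⇒∈nbhd ex) (Adj⇒∈nbhd ey)

  3≤deg : ∀ {u x y z} → Adj T u x → Adj T u y → Adj T u z → x ≢ y → x ≢ z → y ≢ z → 3 ≤ deg T u
  3≤deg ex ey ez = x,y,z∈p⇒3≤∣p∣ (Adj⇒∈nbhd ex) (Adj⇒∈nbhd ey) (Adj⇒∈nbhd ez)

  walk-snoc : ∀ {x y z m} → Walk T x y m → Adj T y z → Walk T x z (suc m)
  walk-snoc []      e = e ∷ []
  walk-snoc (e′ ∷ w) e = e′ ∷ walk-snoc w e

  walk-length-0 : ∀ {x y} → Walk T x y 0 → x ≡ y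
  walk-length-0 [] = refl

  walk? : ∀ m x y → Dec (Walk T x y m)
  walk? zero x y with x Fin.≟ y
  ... | yes refl = yes []
  ... | no x≢y   = no (x≢y ∘ walk-length-0)
  walk? (suc m) x y with Fin.any? (λ z → (adj T x z Bool.≟ true) ×-dec walk? m z y)
  ... | yes (z , e , w) = yes (e ∷ w)
  ... | no ∄z           = no λ { (e ∷ w) → ∄z (_ , e , w) }

  shortest-walk-within : ∀ s x u → (∃[ d ] (d ≤ u × Dist T s x d)) ⊎ (∀ m → m ≤ u → ¬ Walk T s x m)
  shortest-walk-within s x zero with walk? 0 s x
  ... | yes w = inj₁ (0 , z≤n , w , λ _ ())
  ... | no ∄w = inj₂ λ { .zero z≤n → ∄w }
  shortest-walk-within s x (suc u) with shortest-walk-within s x u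
  ... | inj₁ (d , d≤u , dist) = inj₁ (d , m≤n⇒m≤1+n d≤u , dist)
  ... | inj₂ none with walk? (suc u) s x
  ...   | yes w = inj₁ (suc u , ≤-refl , w , λ m m≤u → none m (≤-pred m≤u))
  ...   | no ∄w = inj₂ none′
    where
    none′ : ∀ m → m ≤ suc u → ¬ Walk T s x m
    none′ m m≤1+u with m≤n⇒m<n∨m≡n m≤1+u
    ... | inj₁ m<1+u = none m (≤-pred m<1+u)
    ... | inj₂ refl  = ∄w

  distK-exists : ∀ k s x → ∃[ t ] DistK T k s x t
  distK-exists k s x with shortest-walk-within s x k
  ... | inj₁ (d , d≤k , dist) = d , inj₁ (d≤k , dist)
  ... | inj₂ none             = suc k , inj₂ (refl , none)

  Separates : ℕ → Fin n → Fin n → Fin n → Set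
  Separates k s x y = ∀ t t′ → DistK T k s x t → DistK T k s y t′ → t ≢ t′

  FarFrom : ℕ → Fin n → Fin n → Set
  FarFrom k s x = ∀ m → Walk T s x m → suc k ≤ m

  Shortcut : Fin n → Fin n → Fin n → Set
  Shortcut s x y = ∀ m → Walk T s x m → ∃[ m′ ] (m′ ≤ m × Walk T s y m′)

  module _ {k : ℕ} {s x y : Fin n} where

    far⇒¬Separates : FarFrom k s x → FarFrom k s y → ¬ Separates k s x y
    far⇒¬Separates far-x far-y sep = sep (suc k) (suc k) (distK-far far-x) (distK-far far-y) refl
      where
      distK-far : ∀ {z} → FarFrom k s z → DistK T k s z (suc k)
      distK-far far = inj₂ (refl , λ m m≤k w → <⇒≱ (far m w) m≤k)

    adj⇒¬Separates : 1 ≤ k → Adj T s x → Adj T s y → ¬ Separates k s x y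
    adj⇒¬Separates 1≤k ex ey sep = sep 1 1 (distK-adj ex) (distK-adj ey) refl
      where
      distK-adj : ∀ {z} → Adj T s z → DistK T k s z 1
      distK-adj e = inj₁ (1≤k , (e ∷ []) , λ { .zero (s≤s z≤n) w → Adj⇒≢ e (walk-length-0 w) })

    shortcuts⇒¬Separates : Shortcut s x y → Shortcut s y x → ¬ Separates k s x y
    shortcuts⇒¬Separates x→y y→x sep with distK-exists k s x | distK-exists k s y
    ... | t , dx | t′ , dy = sep t t′ dx dy (distK-≡ x→y y→x dx dy)
      where
      dist-≤ : ∀ {z w t m} → Dist T s z t → Shortcut s w z → Walk T s w m → t ≤ m
      dist-≤ {t = t} (_ , minimal) w→z walk with w→z _ walk
      ... | m′ , m′≤m , walk′ with t ≤? m′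
      ...   | yes t≤m′ = ≤-trans t≤m′ m′≤m
      ...   | no t≰m′  = contradiction walk′ (minimal m′ (≰⇒> t≰m′))

      distK-≡ : ∀ {x y t t′} → Shortcut s x y → Shortcut s y x →
                DistK T k s x t → DistK T k s y t′ → t ≡ t′
      distK-≡ x→y y→x (inj₁ (_ , dist-x)) (inj₁ (_ , dist-y)) =
        ≤-antisym (dist-≤ dist-x y→x (proj₁ dist-y)) (dist-≤ dist-y x→y (proj₁ dist-x))
      distK-≡ x→y y→x (inj₁ (t≤k , wx , _)) (inj₂ (_ , none-y)) with x→y _ wx
      ... | m′ , m′≤t , wy = contradiction wy (none-y m′ (≤-trans m′≤t t≤k))
      distK-≡ x→y y→x (inj₂ (_ , none-x)) (inj₁ (t′≤k , wy , _)) with y→x _ wy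
      ... | m′ , m′≤t′ , wx = contradiction wx (none-x m′ (≤-trans m′≤t′ t′≤k))
      distK-≡ x→y y→x (inj₂ (refl , _)) (inj₂ (refl , _)) = refl

clamp : (ℓ r : ℕ) → Fin (suc ℓ)
clamp ℓ       zero    = F.zero
clamp zero    (suc r) = F.zero
clamp (suc ℓ) (suc r) = F.suc (clamp ℓ r)

toℕ-clamp : ∀ {ℓ r} → r ≤ ℓ → toℕ (clamp ℓ r) ≡ r
toℕ-clamp {ℓ}     {zero}  _         = refl
toℕ-clamp {suc ℓ} {suc r} (s≤s r≤ℓ) = cong suc (toℕ-clamp r≤ℓ)

clamp-toℕ : ∀ {ℓ} (i : Fin (suc ℓ)) → clamp ℓ (toℕ i) ≡ i
clamp-toℕ {ℓ}     F.zero    = refl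
clamp-toℕ {suc ℓ} (F.suc i) = cong F.suc (clamp-toℕ i)

∈-⋃-tabulate : ∀ {m n} (f : Fin m → Fin n) i → f i ∈ ⋃ (List.map ⁅_⁆ (List.tabulate f))
∈-⋃-tabulate f F.zero    = x∈p∪q⁺ (inj₁ (x∈⁅x⁆ (f F.zero)))
∈-⋃-tabulate f (F.suc i) = x∈p∪q⁺ (inj₂ (∈-⋃-tabulate (f ∘ F.suc) i))

module LeafPath {n : ℕ} (T : Graph n) (v : Fin n) (ℓ : ℕ) (P : Fin (suc ℓ) → Fin n)
                (leaf : IsLeafPathFrom T v ℓ P) where

  private
    P-injective : ∀ {i j} → P i ≡ P j → i ≡ j
    P-injective = let (_ , injective , _) = leaf in injective

    P-adj : ∀ (i : Fin ℓ) → Adj T (P (F.inject₁ i)) (P (F.suc i))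
    P-adj = let (_ , _ , adjacent , _) = leaf in adjacent

    deg-P-end : deg T (P (F.fromℕ ℓ)) ≡ 1
    deg-P-end = let (_ , _ , _ , _ , end-is-leaf , _) = leaf in end-is-leaf

    deg-v≥3 : 3 ≤ deg T v
    deg-v≥3 = let (_ , _ , _ , _ , _ , branching , _) = leaf in branching

    deg-P-inner : ∀ i → 0 < toℕ i → toℕ i < ℓ → deg T (P i) ≡ 2
    deg-P-inner = let (_ , _ , _ , _ , _ , _ , inner) = leaf in inner

  at : ℕ → Fin n
  at r = P (clamp ℓ r)

  at-0 : at 0 ≡ v
  at-0 = proj₁ leaf

  at-injective : ∀ {r r′} → r ≤ ℓ → r′ ≤ ℓ → at r ≡ at r′ → r ≡ r′
  at-injective r≤ℓ r′≤ℓ e =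
    trans (sym (toℕ-clamp r≤ℓ)) (trans (cong toℕ (P-injective e)) (toℕ-clamp r′≤ℓ))

  at-adj : ∀ {r} → suc r ≤ ℓ → Adj T (at r) (at (suc r))
  at-adj {r} r<ℓ = subst₂ (Adj T) (cong P (Fin.toℕ-injective e₁)) (cong P (Fin.toℕ-injective e₂)) (P-adj i)
    where
    i = F.fromℕ< r<ℓ
    e₁ : toℕ (F.inject₁ i) ≡ toℕ (clamp ℓ r)
    e₁ = trans (Fin.toℕ-inject₁ i) (trans (Fin.toℕ-fromℕ< r<ℓ) (sym (toℕ-clamp (<⇒≤ r<ℓ))))
    e₂ : toℕ (F.suc i) ≡ toℕ (clamp ℓ (suc r))
    e₂ = trans (cong suc (Fin.toℕ-fromℕ< r<ℓ)) (sym (toℕ-clamp r<ℓ))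

  deg-at-end : deg T (at ℓ) ≡ 1
  deg-at-end = subst (λ i → deg T (P i) ≡ 1) (Fin.toℕ-injective e) deg-P-end
    where
    e : toℕ (F.fromℕ ℓ) ≡ toℕ (clamp ℓ ℓ)
    e = trans (Fin.toℕ-fromℕ ℓ) (sym (toℕ-clamp ≤-refl))

  deg-at-inner : ∀ {r} → 1 ≤ r → suc r ≤ ℓ → deg T (at r) ≡ 2
  deg-at-inner {r} 1≤r r<ℓ =
    deg-P-inner (clamp ℓ r) (≤-trans 1≤r (≤-reflexive (sym e))) (≤-trans (s≤s (≤-reflexive e)) r<ℓ)
    where e = toℕ-clamp (<⇒≤ r<ℓ)

  1≤ℓ : 1 ≤ ℓ
  1≤ℓ with ℓ ≤? 0
  ... | no ℓ≰0  = ≰⇒> ℓ≰0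
  ... | yes ℓ≤0 = contradiction (subst (3 ≤_) deg-v≡1 deg-v≥3) λ { (s≤s ()) }
    where
    deg-v≡1 : deg T v ≡ 1
    deg-v≡1 = trans (cong (deg T) (trans (sym at-0) (cong at (sym (n≤0⇒n≡0 ℓ≤0))))) deg-at-end

  neighbour-at : ∀ {i x} → suc i ≤ ℓ → Adj T x (at (suc i)) →
                 x ≡ at i ⊎ (suc (suc i) ≤ ℓ × x ≡ at (suc (suc i)))
  neighbour-at {i} {x} i<ℓ e with x Fin.≟ at i
  ... | yes x≡prev = inj₁ x≡prev
  ... | no x≢prev with suc (suc i) ≤? ℓ
  ...   | no i+1≮ℓ = contradiction (subst (2 ≤_) deg≡1 two-neighbours) λ { (s≤s ()) }
    where
    two-neighbours = 2≤deg T (Adj-sym T (at-adj i<ℓ)) (Adj-sym T e) (x≢prev ∘ sym)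
    deg≡1 : deg T (at (suc i)) ≡ 1
    deg≡1 = subst (λ r → deg T (at r) ≡ 1) (≤-antisym (≮⇒≥ i+1≮ℓ) i<ℓ) deg-at-end
  ...   | yes i+1<ℓ with x Fin.≟ at (suc (suc i))
  ...     | yes x≡next = inj₂ (i+1<ℓ , x≡next)
  ...     | no x≢next = contradiction (subst (3 ≤_) (deg-at-inner (s≤s z≤n) i+1<ℓ) three-neighbours)
                                      λ { (s≤s (s≤s ())) }
    where
    prev≢next : at i ≢ at (suc (suc i))
    prev≢next e′ with at-injective (≤-trans (n≤1+n i) i<ℓ) i+1<ℓ e′
    ... | ()
    three-neighbours = 3≤deg T (Adj-sym T (at-adj i<ℓ)) (at-adj i+1<ℓ) (Adj-sym T e)
                               prev≢next (x≢prev ∘ sym) (x≢next ∘ sym)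

  -- The position of x on the path; 0 both for v and for vertices off the path.
  index : Fin n → ℕ
  index x with Fin.any? (λ i → P i Fin.≟ x)
  ... | yes (i , _) = toℕ i
  ... | no _        = 0

  index-at : ∀ {r} → r ≤ ℓ → index (at r) ≡ r
  index-at {r} r≤ℓ with Fin.any? (λ i → P i Fin.≟ at r)
  ... | yes (i , Pi≡) = trans (cong toℕ (P-injective Pi≡)) (toℕ-clamp r≤ℓ)
  ... | no ∄i         = contradiction (clamp ℓ r , refl) ∄i

  at-index : ∀ {x} → 1 ≤ index x → at (index x) ≡ x
  at-index {x} pos with Fin.any? (λ i → P i Fin.≟ x)
  ... | yes (i , Pi≡x) = trans (cong P (clamp-toℕ i)) Pi≡x
  ... | no _           = contradiction pos λ ()

  index-≤ : ∀ x → index x ≤ ℓ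
  index-≤ x with Fin.any? (λ i → P i Fin.≟ x)
  ... | yes (i , _) = Fin.toℕ≤pred[n] i
  ... | no _        = z≤n

  index-v : index v ≡ 0
  index-v = trans (cong index (sym at-0)) (index-at z≤n)

  neighbour-index : ∀ {x y i} → Adj T x y → index y ≡ suc i → x ≡ at i ⊎ index x ≡ suc (suc i)
  neighbour-index {x} {y} {i} e iy≡ with neighbour-at i<ℓ (subst (Adj T x) (sym at-i+1) e)
    where
    i<ℓ = ≤-trans (≤-reflexive (sym iy≡)) (index-≤ y)
    at-i+1 : at (suc i) ≡ y
    at-i+1 = trans (cong at (sym iy≡)) (at-index (≤-trans (s≤s z≤n) (≤-reflexive (sym iy≡))))
  ... | inj₁ x≡ = inj₁ x≡
  ... | inj₂ (i+1<ℓ , x≡) = inj₂ (trans (cong index x≡) (index-at i+1<ℓ))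

  index-adj : ∀ {x y} → Adj T x y → index y ≤ suc (index x)
  index-adj {x} {y} e with index y in iy≡
  ... | zero  = z≤n
  ... | suc i with neighbour-index e iy≡
  ...   | inj₁ x≡ = s≤s (≤-reflexive (sym (trans (cong index x≡) (index-at i≤ℓ))))
    where i≤ℓ = ≤-trans (n≤1+n i) (≤-trans (≤-reflexive (sym iy≡)) (index-≤ y))
  ...   | inj₂ ix≡ = s≤s (≤-trans (n≤1+n i) (≤-trans (n≤1+n _) (≤-reflexive (sym ix≡))))

  enter-path : ∀ {x y} → Adj T x y → index x ≡ 0 → 1 ≤ index y → x ≡ v × index y ≡ 1
  enter-path {x} {y} e ix≡0 pos with index y in iy≡
  ... | suc i with neighbour-index e iy≡
  ...   | inj₂ ix≡ = contradiction (trans (sym ix≡0) ix≡) λ ()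
  ...   | inj₁ x≡at-i = trans x≡at-i (trans (cong at i≡0) at-0) , cong suc i≡0
    where
    i≡0 : i ≡ 0
    i≡0 = trans (sym (index-at (≤-trans (n≤1+n i) (≤-trans (≤-reflexive (sym iy≡)) (index-≤ y)))))
                (trans (cong index (sym x≡at-i)) ix≡0)

  walk-index-up : ∀ {x y m} → Walk T x y m → index y ≤ index x + m
  walk-index-up {x} []                = m≤m+n (index x) 0
  walk-index-up {x} {m = suc m} (e ∷ w) =
    ≤-trans (walk-index-up w)
            (≤-trans (+-monoˡ-≤ m (index-adj e)) (≤-reflexive (sym (+-suc (index x) m))))

  walk-index-down : ∀ {x y m} → Walk T x y m → index x ≤ index y + m
  walk-index-down {x}                  []      = m≤m+n (index x) 0
  walk-index-down {y = y} {m = suc m} (e ∷ w) =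
    ≤-trans (index-adj (Adj-sym T e))
            (≤-trans (s≤s (walk-index-down w)) (≤-reflexive (sym (+-suc (index y) m))))

  -- The path hangs off the rest of the graph at v only.
  walk-via-v : ∀ {s z m} → Walk T s z m → index s ≡ 0 → 1 ≤ index z →
               ∃[ m′ ] (Walk T s v m′ × m′ + index z ≤ m)
  walk-via-v [] is≡0 pos = contradiction (subst (1 ≤_) is≡0 pos) λ ()
  walk-via-v {m = suc m} (_∷_ {y = y} e w) is≡0 pos with index y ≟ 0
  ... | yes iy≡0 = let (m′ , w′ , m′+iz≤m) = walk-via-v w iy≡0 pos in suc m′ , e ∷ w′ , s≤s m′+iz≤m
  ... | no iy≢0 with enter-path e is≡0 (n≢0⇒n>0 iy≢0)
  ...   | refl , _ = 0 , [] , ≤-trans (walk-index-up (e ∷ w)) (≤-reflexive (cong (_+ suc m) is≡0))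

  far-below : ∀ {k s r} → r ≤ ℓ → index s + suc k ≤ r → FarFrom T k s (at r)
  far-below {s = s} r≤ℓ gap m w =
    +-cancelˡ-≤ (index s) _ _ (≤-trans gap (≤-trans (≤-reflexive (sym (index-at r≤ℓ))) (walk-index-up w)))

  far-above : ∀ {k s r} → r ≤ ℓ → r + suc k ≤ index s → FarFrom T k s (at r)
  far-above {r = r} r≤ℓ gap m w =
    +-cancelˡ-≤ r _ _ (≤-trans gap (≤-trans (walk-index-down w) (≤-reflexive (cong (_+ m) (index-at r≤ℓ)))))

  module Landmarks (k : ℕ) (S : Subset n) where

    inS : ℕ → Bool
    inS r = does (at r ∈? S)

    inS⇒∈ : ∀ {r} → inS r ≡ true → at r ∈ S
    inS⇒∈ {r} e with at r ∈? S
    ... | yes at-r∈S = at-r∈S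

    index-inS : ∀ {s} → s ∈ S → 1 ≤ index s → inS (index s) ≡ true
    index-inS {s} s∈S pos = dec-true (at (index s) ∈? S) (subst (_∈ S) (sym (at-index pos)) s∈S)

    count≤∣p∣ : ∀ {r} (p : Subset n) → r ≤ ℓ → (∀ {t} → 1 ≤ t → t ≤ r → inS t ≡ true → at t ∈ p) →
                count inS r ≤ ∣ p ∣
    count≤∣p∣ {zero}  p _   _     = z≤n
    count≤∣p∣ {suc r} p r<ℓ at∈p with inS (suc r) in eq
    ... | false = count≤∣p∣ p (<⇒≤ r<ℓ) λ 1≤t t≤r → at∈p 1≤t (m≤n⇒m≤1+n t≤r)
    ... | true  = ≤-trans (s≤s (count≤∣p∣ (p - at (suc r)) (<⇒≤ r<ℓ) at∈p-r))
                          (x∈p⇒∣p-x∣<∣p∣ (at∈p (s≤s z≤n) ≤-refl eq))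
      where
      at∈p-r : ∀ {t} → 1 ≤ t → t ≤ r → inS t ≡ true → at t ∈ p - at (suc r)
      at∈p-r {t} 1≤t t≤r st = x∈p∧x≢y⇒x∈p-y (at∈p 1≤t (m≤n⇒m≤1+n t≤r) st)
        λ e → <⇒≢ (s≤s t≤r) (at-injective (≤-trans t≤r (<⇒≤ r<ℓ)) r<ℓ e)

    count≤countOn : count inS ℓ ≤ countOn S P v
    count≤countOn = count≤∣p∣ _ ≤-refl λ {t} 1≤t t≤ℓ st →
      x∈p∩q⁺ (inS⇒∈ st , x∈p∧x∉q⇒x∈p─q (∈-⋃-tabulate P (clamp ℓ t))
        λ at-t∈⁅v⁆ → <⇒≢ 1≤t (sym (at-injective t≤ℓ z≤n (trans (x∈⁅y⁆⇒x≡y v at-t∈⁅v⁆) (sym at-0)))))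

    covers : ThresholdResolving T k S → Covers k ℓ inS
    covers (_ , dominating) i k<i i≤ℓ with dominating (at i)
    ... | s , s∈S , d , d≤k , walk , _ with index s ≟ 0
    ...   | yes is≡0 =
      contradiction d≤k (<⇒≱ (far-below i≤ℓ (subst (λ b → b + suc k ≤ i) (sym is≡0) k<i) d walk))
    ...   | no is≢0  = index s , index-inS s∈S (n≢0⇒n>0 is≢0) , index-≤ s ,
      ≤-trans (≤-reflexive (sym (index-at i≤ℓ))) (≤-trans (walk-index-up walk) (+-monoʳ-≤ (index s) d≤k)) ,
      ≤-trans (walk-index-down walk) (≤-trans (≤-reflexive (cong (_+ d) (index-at i≤ℓ))) (+-monoʳ-≤ i d≤k))

    -- The neighbours of an inner landmark must be told apart by a landmark within k + 1 of it.
    paired : 1 ≤ k → ThresholdResolving T k S → Paired k ℓ inS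
    paired 1≤k (resolving , _) (suc a) _ k+1<a+1 a+1<ℓ =
      partner (resolving (at a) (at (suc (suc a))) λ e → contradiction (at-injective a≤ℓ a+1<ℓ e) λ ())
      where
      a≤ℓ = ≤-trans (n≤1+n a) (≤-trans (n≤1+n _) a+1<ℓ)

      partner : ∃[ s ] (s ∈ S × Separates T k s (at a) (at (suc (suc a)))) →
                ∃[ b ] (inS b ≡ true × b ≤ ℓ × b ≢ suc a × b ≤ suc a + suc k × suc a ≤ b + suc k)
      partner (s , s∈S , separates)
        with index s ≟ suc a | suc a ≤? index s + suc k | index s ≤? suc a + suc k
      ... | yes is≡a+1 | _ | _ = contradiction separates
        (adj⇒¬Separates T 1≤k
          (subst (λ u → Adj T u (at a)) at-a+1≡s (Adj-sym T (at-adj (≤-trans (n≤1+n _) a+1<ℓ))))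
          (subst (λ u → Adj T u (at (suc (suc a)))) at-a+1≡s (at-adj a+1<ℓ)))
        where
        at-a+1≡s : at (suc a) ≡ s
        at-a+1≡s = trans (cong at (sym is≡a+1)) (at-index (≤-trans (s≤s z≤n) (≤-reflexive (sym is≡a+1))))
      ... | no is≢a+1 | yes a+1≤ | yes is≤ =
        index s , index-inS s∈S (+-cancelʳ-≤ (suc k) 1 (index s) (≤-trans k+1<a+1 a+1≤)) ,
        index-≤ s , is≢a+1 , is≤ , a+1≤
      ... | no _ | no a+1≰ | _ = contradiction separates
        (far⇒¬Separates T
          (far-below a≤ℓ (≤-pred (≰⇒> a+1≰)))
          (far-below a+1<ℓ (≤-trans (≤-pred (≰⇒> a+1≰)) (≤-trans (n≤1+n a) (n≤1+n _)))))
      ... | no _ | yes _ | no is≰ = contradiction separates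
        (far⇒¬Separates T
          (far-above a≤ℓ (≤-trans (+-monoˡ-≤ (suc k) (≤-trans (n≤1+n a) (n≤1+n _))) (≰⇒> is≰)))
          (far-above a+1<ℓ (≰⇒> is≰)))

module _ {n : ℕ} (T : Graph n) (v : Fin n)
         {ℓ₁ ℓ₂ : ℕ} {P₁ : Fin (suc ℓ₁) → Fin n} {P₂ : Fin (suc ℓ₂) → Fin n}
         (leaf₁ : IsLeafPathFrom T v ℓ₁ P₁) (leaf₂ : IsLeafPathFrom T v ℓ₂ P₂) where

  private
    module L₁ = LeafPath T v ℓ₁ P₁ leaf₁
    module L₂ = LeafPath T v ℓ₂ P₂ leaf₂

  -- Past its first edge a leaf path has no choice: inner vertices have degree 2.
  leafPaths-agree : L₁.at 1 ≡ L₂.at 1 → pathVertices P₁ ≡ pathVertices P₂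
  leafPaths-agree at₁1≡at₂1 = vertices lengths
    where
    agree : ∀ {r} → r ≤ ℓ₁ → r ≤ ℓ₂ → L₁.at r ≡ L₂.at r
    agree {zero}        _    _    = trans L₁.at-0 (sym L₂.at-0)
    agree {suc zero}    _    _    = at₁1≡at₂1
    agree {suc (suc r)} r≤ℓ₁ r≤ℓ₂ = step (agree r≤ℓ₁′ r≤ℓ₂′) (agree (<⇒≤ r≤ℓ₁) (<⇒≤ r≤ℓ₂))
      where
      r≤ℓ₁′ = ≤-trans (n≤1+n r) (≤-trans (n≤1+n _) r≤ℓ₁)
      r≤ℓ₂′ = ≤-trans (n≤1+n r) (≤-trans (n≤1+n _) r≤ℓ₂)

      step : L₁.at r ≡ L₂.at r → L₁.at (suc r) ≡ L₂.at (suc r) → L₁.at (suc (suc r)) ≡ L₂.at (suc (suc r))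
      step same-r same-r+1
        with L₂.neighbour-at (<⇒≤ r≤ℓ₂) (subst (Adj T _) same-r+1 (Adj-sym T (L₁.at-adj r≤ℓ₁)))
      ... | inj₂ (_ , e) = e
      ... | inj₁ e = contradiction (L₁.at-injective r≤ℓ₁ r≤ℓ₁′ (trans e (sym same-r))) λ ()

    lengths : ℓ₁ ≡ ℓ₂
    lengths with <-cmp ℓ₁ ℓ₂
    ... | tri≈ _ e _     = e
    ... | tri< ℓ₁<ℓ₂ _ _ = contradiction (trans (sym L₁.deg-at-end)
        (trans (cong (deg T) (agree ≤-refl (<⇒≤ ℓ₁<ℓ₂))) (L₂.deg-at-inner L₁.1≤ℓ ℓ₁<ℓ₂))) λ ()
    ... | tri> _ _ ℓ₂<ℓ₁ = contradiction (trans (sym L₂.deg-at-end)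
        (trans (cong (deg T) (sym (agree (<⇒≤ ℓ₂<ℓ₁) ≤-refl))) (L₁.deg-at-inner L₂.1≤ℓ ℓ₂<ℓ₁))) λ ()

    vertices : ℓ₁ ≡ ℓ₂ → pathVertices P₁ ≡ pathVertices P₂
    vertices refl = List.tabulate-cong λ i → begin
      P₁ i                    ≡⟨ cong P₁ (clamp-toℕ i) ⟨
      L₁.at (toℕ i)           ≡⟨ agree (Fin.toℕ≤pred[n] i) (Fin.toℕ≤pred[n] i) ⟩
      L₂.at (toℕ i)           ≡⟨ cong P₂ (clamp-toℕ i) ⟩
      P₂ i                    ∎
      where open ≡-Reasoning

module LeafPathsFrom (k : ℕ) (1≤k : 1 ≤ k) {n : ℕ} (T : Graph n)
                     (S : Subset n) (TR : ThresholdResolving T k S)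
                     (v : Fin n) {L : ℕ} (ℓ : Fin L → ℕ) (P : (j : Fin L) → Fin (suc (ℓ j)) → Fin n)
                     (leaf : ∀ j → IsLeafPathFrom T v (ℓ j) (P j))
                     (distinct : ∀ i j → i ≢ j → pathVertices (P i) ≢ pathVertices (P j)) where

  module Path (j : Fin L) where
    open LeafPath T v (ℓ j) (P j) (leaf j) public
    open Landmarks k S public

  open Path

  cunder≤countOn : ∀ j → cunder k (ℓ j) ≤ countOn S (P j) v
  cunder≤countOn j =
    ≤-trans (Scan.cunder-≤-count k (ℓ j) (inS j) (covers j TR) (paired j 1≤k TR)) (count≤countOn j)

  Deficient : Fin L → Set
  Deficient j = count (inS j) (ℓ j) < cbar k (ℓ j)

  deficient? : ∀ j → Dec (Deficient j)
  deficient? j = count (inS j) (ℓ j) <? cbar k (ℓ j)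

  cbar≤countOn : ∀ j → ¬ Deficient j → cbar k (ℓ j) ≤ countOn S (P j) v
  cbar≤countOn j ¬deficient = ≤-trans (≮⇒≥ ¬deficient) (count≤countOn j)

  deficient⇒landmarks-far : ∀ {j s} → Deficient j → s ∈ S → 1 ≤ index j s → suc (suc k) ≤ index j s
  deficient⇒landmarks-far {j} {s} deficient s∈S pos with index j s ≤? suc k
  ... | no is≰k+1  = ≰⇒> is≰k+1
  ... | yes is≤k+1 = contradiction
    (cbar-≤-count (covers j TR) (paired j 1≤k TR) (index-inS j s∈S pos) pos is≤k+1 (index-≤ j s))
    (<⇒≱ deficient)

  v-adj-at-1 : ∀ j → Adj T v (at j 1)
  v-adj-at-1 j = subst (λ u → Adj T u (at j 1)) (at-0 j) (at-adj j (1≤ℓ j))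

  at-1-≢ : ∀ {j m} → j ≢ m → at j 1 ≢ at m 1
  at-1-≢ {j} {m} j≢m = distinct j m j≢m ∘ leafPaths-agree T v (leaf j) (leaf m)

  off-path : ∀ {j m} → j ≢ m → ∀ {r} → 1 ≤ r → r ≤ ℓ j → index m (at j r) ≡ 0
  off-path {j} {m} j≢m {suc zero} _ _ with index m (at j 1) ≟ 0
  ... | yes i≡0 = i≡0
  ... | no i≢0 = contradiction (sym (trans (cong (at m) (sym i≡1)) (at-index m pos))) (at-1-≢ j≢m)
    where
    pos = n≢0⇒n>0 i≢0
    i≡1 = proj₂ (enter-path m (v-adj-at-1 j) (index-v m) pos)
  off-path {j} {m} j≢m {suc (suc r)} _ r<ℓ =
    step (off-path j≢m {suc r} (s≤s z≤n) (≤-trans (n≤1+n _) r<ℓ))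
    where
    step : index m (at j (suc r)) ≡ 0 → index m (at j (suc (suc r))) ≡ 0
    step prev≡0 with index m (at j (suc (suc r))) ≟ 0
    ... | yes i≡0 = i≡0
    ... | no i≢0 =
      contradiction (at-injective j (≤-trans (n≤1+n _) r<ℓ) z≤n (trans at-r+1≡v (sym (at-0 j)))) λ ()
      where at-r+1≡v = proj₁ (enter-path m (at-adj j r<ℓ) prev≡0 (n≢0⇒n>0 i≢0))

  -- From s, both vertices are reached only by walking down path j past its first k + 1 positions.
  far-from-both : ∀ {j m s} → j ≢ m → Deficient j → s ∈ S → 1 ≤ index j s →
                  FarFrom T k s (at j 1) × FarFrom T k s (at m 1)
  far-from-both {j} {m} {s} j≢m deficient s∈S pos = far-above j (1≤ℓ j) deep , far-m
    where
    deep = deficient⇒landmarks-far deficient s∈S pos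
    im-s≡0 : index m s ≡ 0
    im-s≡0 = trans (cong (index m) (sym (at-index j pos))) (off-path j≢m pos (index-≤ j s))
    far-m : FarFrom T k s (at m 1)
    far-m w walk with walk-via-v m walk im-s≡0 (≤-reflexive (sym (index-at m (1≤ℓ m))))
    ... | w′ , walk′ , w′+1≤w = begin
      suc k                 ≤⟨ n≤1+n _ ⟩
      suc (suc k)           ≤⟨ deep ⟩
      index j s             ≤⟨ walk-index-down j walk′ ⟩
      index j v + w′        ≡⟨ cong (_+ w′) (index-v j) ⟩
      w′                    ≤⟨ m≤m+n w′ _ ⟩
      w′ + index m (at m 1) ≤⟨ w′+1≤w ⟩
      w                     ∎
      where open ≤-Reasoning

  via-v : ∀ {j s} m → index j s ≡ 0 → Shortcut T s (at j 1) (at m 1)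
  via-v {j} m ij-s≡0 w walk with walk-via-v j walk ij-s≡0 (≤-reflexive (sym (index-at j (1≤ℓ j))))
  ... | w′ , walk′ , w′+1≤w = suc w′ , 1+w′≤w , walk-snoc T walk′ (v-adj-at-1 m)
    where
    1+w′≤w : suc w′ ≤ w
    1+w′≤w = ≤-trans (≤-reflexive (trans (+-comm 1 w′) (cong (w′ +_) (sym (index-at j (1≤ℓ j)))))) w′+1≤w

  at-most-one-deficient : ∀ {j m} → j ≢ m → Deficient j → Deficient m → ⊥
  at-most-one-deficient {j} {m} j≢m dj dm with proj₁ TR (at j 1) (at m 1) (at-1-≢ j≢m)
  ... | s , s∈S , separates with index j s ≟ 0 | index m s ≟ 0
  ... | no ij≢0 | _ = let (far-j , far-m) = far-from-both j≢m dj s∈S (n≢0⇒n>0 ij≢0) in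
                      far⇒¬Separates T far-j far-m separates
  ... | yes _ | no im≢0 = let (far-m , far-j) = far-from-both (j≢m ∘ sym) dm s∈S (n≢0⇒n>0 im≢0) in
                          far⇒¬Separates T far-j far-m separates
  ... | yes ij≡0 | yes im≡0 = shortcuts⇒¬Separates T (via-v m ij≡0) (via-v j im≡0) separates

lemma2p8 : (k : ℕ) → 1 ≤ k → {n : ℕ} → (T : Graph n) → IsTree T →
  (S : Subset n) → ThresholdResolving T k S →
  (v : Fin n) → 3 ≤ deg T v →
  (L : ℕ) → 2 ≤ L → (ℓ : Fin L → ℕ) → (P : (j : Fin L) → Fin (suc (ℓ j)) → Fin n) →
  (∀ j → IsLeafPathFrom T v (ℓ j) (P j)) →
  (∀ i j → i ≢ j → pathVertices (P i) ≢ pathVertices (P j)) →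
  (∀ (m : ℕ) (Q : Fin (suc m) → Fin n) → IsLeafPathFrom T v m Q →
     ∃[ j ] (pathVertices Q ≡ pathVertices (P j))) →
  ∃[ jstar ] ((∀ j → j ≢ jstar → cbar k (ℓ j) ≤ countOn S (P j) v)
             × cunder k (ℓ jstar) ≤ countOn S (P jstar) v)
lemma2p8 k 1≤k T _ S resolving v _ L 2≤L ℓ P leaf distinct _ = pick (Fin.any? deficient?)
  where
  open LeafPathsFrom k 1≤k T S resolving v ℓ P leaf distinct
  pick : Dec (∃[ j ] Deficient j) →
         ∃[ j⋆ ] ((∀ j → j ≢ j⋆ → cbar k (ℓ j) ≤ countOn S (P j) v) × cunder k (ℓ j⋆) ≤ countOn S (P j⋆) v)
  pick (yes (j⋆ , j⋆-deficient)) =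
    j⋆ , (λ j j≢j⋆ → cbar≤countOn j λ j-deficient → at-most-one-deficient j≢j⋆ j-deficient j⋆-deficient) ,
    cunder≤countOn j⋆
  pick (no ∄deficient) =
    F.fromℕ< 2≤L , (λ j _ → cbar≤countOn j λ j-deficient → ∄deficient (j , j-deficient)) , cunder≤countOn _
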